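{- Let $\Gamma$ be a connected $m$-regular graph and let $u$ be an eigenvector of (the adjacency matrix of) $\Gamma$ taking exactly three distinct values $a_0,a_1,a_2$. For $i\in\{0,1,2\}$ let $C^i$ be the set of vertices $x$ with $u_x=a_i$. Suppose that no vertex of $C^0$ is adjacent to a vertex of $C^2$, and that there is a number $\beta_1$ such that every vertex of $C^1$ is adjacent to exactly $\beta_1$ vertices of $C^2$. Then $C^0$ is a completely regular code in $\Gamma$.
   Context: For a code (vertex subset) $C$ of a connected graph, $C_i$ denotes the set of vertices at distance exactly $i$ from $C$, and the covering radius $\rho$ is the maximum such distance. $C$ is completely regular if there are numbers $\alpha_i,\beta_i,\gamma_i$ such that every vertex of $C_i$ has exactly $\gamma_i$ neighbours in $C_{i-1}$, $\alpha_i$ neighbours in $C_i$ and $\beta_i$ neighbours in $C_{i+1}$, for all $0\le i\le\rho$ (with $\gamma_0=\beta_\rho=0$). -}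

module Defs where

open import Level using (Level)
open import Data.Bool using (Bool; true; false; _∧_; _∨_; not)
open import Data.Nat using (ℕ; zero; suc; _≤_)
open import Data.Fin using (Fin)
open import Data.List using (List; []; _∷_; filter; length; foldr; map)
open import Data.Bool.ListAction using (any)
open import Data.List.Base using (allFin)
open import Data.Product using (Σ; ∃; _×_; _,_)
open import Relation.Nullary using (¬_)
open import Relation.Binary.PropositionalEquality using (_≡_)
open import Relation.Binary.Construct.Closure.ReflexiveTransitive using (Star)
open import Algebra.Bundles using (CommutativeRing; Semiring)

record Graph (n : ℕ) : Set where
  field
    adj     : Fin n → Fin n → Bool
    sym     : ∀ x y → adj x y ≡ adj y x
    irrefl  : ∀ x → adj x x ≡ false

open Graph public

Adj : ∀ {n} → Graph n → Fin n → Fin n → Set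
Adj Γ x y = adj Γ x y ≡ true

Connected : ∀ {n} → Graph n → Set
Connected Γ = ∀ x y → Star (Adj Γ) x y

count : ∀ {n} → (Fin n → Bool) → ℕ
count {n} P = length (filter (λ y → P y Data.Bool.≟ true) (allFin n))

nbrsIn : ∀ {n} → Graph n → (Fin n → Bool) → Fin n → ℕ
nbrsIn Γ S x = count (λ y → adj Γ x y ∧ S y)

Regular : ∀ {n} → Graph n → ℕ → Set
Regular Γ m = ∀ x → nbrsIn Γ (λ _ → true) x ≡ m

-- Distance from a code.  ball Γ C k x = true iff d(x, C) ≤ k
-- (the vertices reachable from C by a walk of length ≤ k).

ball : ∀ {n} → Graph n → (Fin n → Bool) → ℕ → Fin n → Bool
ball Γ C zero    x = C x
ball {n} Γ C (suc k) x =
  ball Γ C k x ∨ any (λ y → adj Γ x y ∧ ball Γ C k y) (allFin n)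

layer : ∀ {n} → Graph n → (Fin n → Bool) → ℕ → Fin n → Bool
layer Γ C zero    x = C x
layer Γ C (suc i) x = ball Γ C (suc i) x ∧ not (ball Γ C i x)

CoveringRadius : ∀ {n} → Graph n → (Fin n → Bool) → ℕ → Set
CoveringRadius {n} Γ C ρ =
  (∀ x → ball Γ C ρ x ≡ true) × (∃ λ x → layer Γ C ρ x ≡ true)

-- Completely regular code (with C_{-1} = C_{ρ+1} = ∅ as in the paper:
-- γ 0 = 0 and β ρ = 0 are then forced).
CompletelyRegular : ∀ {n} → Graph n → (Fin n → Bool) → Set
CompletelyRegular Γ C =
  Σ ℕ λ ρ → CoveringRadius Γ C ρ ×
  Σ (ℕ → ℕ) λ γ → Σ (ℕ → ℕ) λ α → Σ (ℕ → ℕ) λ β →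
    γ 0 ≡ 0 × β ρ ≡ 0 ×
    (∀ i → i ≤ ρ → ∀ x → layer Γ C i x ≡ true →
        nbrsIn Γ (prevLayer i) x ≡ γ i
      × nbrsIn Γ (layer Γ C i) x ≡ α i
      × nbrsIn Γ (layer Γ C (suc i)) x ≡ β i)
  where
  prevLayer : ℕ → Fin _ → Bool
  prevLayer zero    _ = false
  prevLayer (suc i) = layer Γ C i

-- Fields of characteristic zero (ℝ being the case of the paper),
-- presented as a commutative ring with the field axioms.

module _ {c ℓ : Level} (R : CommutativeRing c ℓ) where
  open CommutativeRing R
  open import Algebra.Definitions.RawSemiring (Semiring.rawSemiring semiring) using () renaming (_×_ to _·ℕ_)

  IsFieldCharZero : Set (c Level.⊔ ℓ)
  IsFieldCharZero =
      (¬ (1# ≈ 0#))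
    × (∀ x → ¬ (x ≈ 0#) → ∃ λ y → x * y ≈ 1#)
    × (∀ k → ¬ ((suc k ·ℕ 1#) ≈ 0#))

  nbrSum : ∀ {n} → Graph n → (Fin n → Carrier) → Fin n → Carrier
  nbrSum {n} Γ f x =
    foldr _+_ 0# (map f (filter (λ y → adj Γ x y Data.Bool.≟ true) (allFin n)))

  IsEigenvector : ∀ {n} → Graph n → (Fin n → Carrier) → Carrier → Set ℓ
  IsEigenvector Γ u θ =
    (∃ λ x → ¬ (u x ≈ 0#)) × (∀ x → nbrSum Γ u x ≈ θ * u x)

-- Write nʲ(x) for the number of neighbours of x in Cʲ. Regularity and the
-- eigenvalue equation at x ∈ Cⁱ give
--   n⁰(x) + n¹(x) + n²(x) = m   and   n⁰(x)·a₀ + n¹(x)·a₁ + n²(x)·a₂ = θ·aᵢ.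
-- On each class one count is known (n² = 0 on C⁰, n² = β₁ on C¹, n⁰ = 0 on C²),
-- and the other two are then determined: if two vertices of the class had
-- these counts differing by d, then d·b = d·c for two distinct values b, c
-- among the aⱼ, which forces d = 0 in characteristic zero.
-- So {C⁰, C¹, C²} is an equitable partition. By connectivity some vertex of C¹
-- is adjacent to C⁰ and some vertex of C² to C¹, hence all are, so the
-- partition is the distance partition of C⁰, with covering radius 2.

module Submission where

open import Defs
open import Level using (Level)
open import Data.Nat as ℕ using (ℕ; zero; suc; _<_; _≤_; s≤s)
import Data.Nat.Properties as ℕₚ
open import Data.Fin using (Fin; zero; suc; _≟_; toℕ)
open import Data.Fin.Patterns using (0F; 1F; 2F)
open import Data.Bool as Bool using (Bool; true; false; _∧_; _∨_; not)
open import Data.Bool.Properties using (T-≡; ∧-zeroʳ)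
open import Data.Bool.ListAction using (any)
open import Data.List using (List; []; _∷_; filter; length; foldr; map; allFin)
open import Data.List.Properties using (filter-≐; filter-none; filter-some)
open import Data.List.Membership.Propositional using (_∈_; lose)
open import Data.List.Membership.Propositional.Properties using (∈-filter⁻; ∈-allFin)
open import Data.List.Relation.Unary.Any using (here)
open import Data.List.Relation.Unary.Any.Properties using (any⁺)
open import Data.List.Relation.Unary.All using (universal)
open import Data.Product using (∃; ∃₂; _×_; _,_; proj₁; proj₂)
open import Data.Sum using (inj₁; inj₂)
open import Data.Empty using (⊥-elim)
open import Function using (Equivalence)
open import Relation.Nullary using (¬_; yes)
open import Relation.Nullary.Decidable using (⌊_⌋; isYes≗does; dec-true; dec-false)
open import Relation.Binary.PropositionalEquality as ≡ using (_≡_; refl; cong; cong₂; subst)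
open import Relation.Binary.Construct.Closure.ReflexiveTransitive using (Star; ε; _◅_)
open import Algebra.Bundles using (CommutativeRing; CommutativeMonoid)

∧-true⁻ : ∀ {b c} → b ∧ c ≡ true → b ≡ true × c ≡ true
∧-true⁻ {true} {true} _ = refl , refl

∧-true⁺ : ∀ {b c} → b ≡ true → c ≡ true → b ∧ c ≡ true
∧-true⁺ refl refl = refl

module _ {A : Set} where

  countIn : (A → Bool) → List A → ℕ
  countIn P xs = length (filter (λ y → P y Bool.≟ true) xs)

  countIn-cong : ∀ {P Q : A → Bool} → (∀ y → P y ≡ Q y) → ∀ xs → countIn P xs ≡ countIn Q xs
  countIn-cong P≗Q xs =
    cong length (filter-≐ _ _ ((λ p → ≡.trans (≡.sym (P≗Q _)) p) , (λ q → ≡.trans (P≗Q _) q)) xs)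

  countIn-none : ∀ {P : A → Bool} → (∀ y → P y ≡ false) → ∀ xs → countIn P xs ≡ 0
  countIn-none {P} P≡false xs = cong length (filter-none _ (universal P≢true xs))
    where
    P≢true : ∀ y → ¬ P y ≡ true
    P≢true y Py with ≡.trans (≡.sym (P≡false y)) Py
    ... | ()

  countIn-pos : ∀ {P : A → Bool} {y xs} → y ∈ xs → P y ≡ true → 0 < countIn P xs
  countIn-pos y∈xs Py = filter-some _ (lose y∈xs Py)

  countIn-witness : ∀ (P : A → Bool) xs → 0 < countIn P xs → ∃ λ y → P y ≡ true
  countIn-witness P xs pos with filter (λ y → P y Bool.≟ true) xs in eq
  ... | y ∷ _ =
    y , proj₂ (∈-filter⁻ (λ y → P y Bool.≟ true) {xs = xs} (subst (y ∈_) (≡.sym eq) (here refl)))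

  countIn-∧ : ∀ (P Q : A → Bool) xs →
    countIn (λ y → P y ∧ Q y) xs ≡ countIn Q (filter (λ y → P y Bool.≟ true) xs)
  countIn-∧ P Q [] = refl
  countIn-∧ P Q (y ∷ ys) with P y
  ... | false = countIn-∧ P Q ys
  ... | true with Q y
  ...   | true  = cong suc (countIn-∧ P Q ys)
  ...   | false = countIn-∧ P Q ys

  countIn-true : ∀ xs → countIn (λ _ → true) xs ≡ length xs
  countIn-true []       = refl
  countIn-true (_ ∷ xs) = cong suc (countIn-true xs)

  any-true : ∀ (p : A → Bool) {y xs} → y ∈ xs → p y ≡ true → any p xs ≡ true
  any-true p y∈xs py = Equivalence.to T-≡ (any⁺ p (lose y∈xs (Equivalence.from T-≡ py)))

  any-false : ∀ (p : A → Bool) → (∀ y → p y ≡ false) → ∀ xs → any p xs ≡ false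
  any-false p none []       = refl
  any-false p none (y ∷ ys) with p y | none y
  ... | false | refl = any-false p none ys

  fibre : ∀ {k} → (A → Fin k) → Fin k → A → Bool
  fibre c i y = ⌊ c y ≟ i ⌋

  fibre⁺ : ∀ {k} (c : A → Fin k) {i y} → c y ≡ i → fibre c i y ≡ true
  fibre⁺ c {i} {y} cy≡i = ≡.trans (isYes≗does (c y ≟ i)) (dec-true (c y ≟ i) cy≡i)

  fibre⁻ : ∀ {k} (c : A → Fin k) {i y} → fibre c i y ≡ true → c y ≡ i
  fibre⁻ c {i} {y} with c y ≟ i
  ... | yes cy≡i = λ _ → cy≡i

  fibre-≢ : ∀ {k} (c : A → Fin k) {i j y} → c y ≡ j → ¬ j ≡ i → fibre c i y ≡ false
  fibre-≢ c {i} {y = y} cy≡j j≢i =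
    ≡.trans (isYes≗does (c y ≟ i)) (dec-false (c y ≟ i) (λ cy≡i → j≢i (≡.trans (≡.sym cy≡j) cy≡i)))

  length-by-fibres : ∀ (c : A → Fin 3) xs →
    length xs ≡ (countIn (fibre c 0F) xs ℕ.+ countIn (fibre c 1F) xs) ℕ.+ countIn (fibre c 2F) xs
  length-by-fibres c [] = refl
  length-by-fibres c (y ∷ ys) with c y
  ... | 0F = cong suc (length-by-fibres c ys)
  ... | 1F = ≡.trans (cong suc (length-by-fibres c ys))
               (cong (ℕ._+ countIn (fibre c 2F) ys) (≡.sym (ℕₚ.+-suc (countIn (fibre c 0F) ys) _)))
  ... | 2F = ≡.trans (cong suc (length-by-fibres c ys)) (≡.sym (ℕₚ.+-suc _ _))

module _ {c ℓ : Level} (M : CommutativeMonoid c ℓ) where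
  open CommutativeMonoid M renaming (_∙_ to _+_; ε to 0#; refl to ≈-refl; sym to ≈-sym; trans to ≈-trans)
  open import Algebra.Properties.Monoid.Mult monoid renaming (_×_ to _·_) using ()
  open import Algebra.Solver.CommutativeMonoid M using (solve; _⊜_; _⊕_)

  sum-by-fibres : ∀ {A : Set} (u : A → Carrier) (a : Fin 3 → Carrier) (c : A → Fin 3) →
    (∀ y → u y ≈ a (c y)) → ∀ xs →
    foldr _+_ 0# (map u xs) ≈
      (countIn (fibre c 0F) xs · a 0F + countIn (fibre c 1F) xs · a 1F) + countIn (fibre c 2F) xs · a 2F
  sum-by-fibres u a c u≈a [] = ≈-sym (≈-trans (identityʳ _) (identityʳ _))
  sum-by-fibres u a c u≈a (y ∷ ys) with c y | u≈a y
  ... | 0F | uy≈a = ≈-trans (∙-cong uy≈a (sum-by-fibres u a c u≈a ys))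
    (solve 4 (λ w x y z → w ⊕ ((x ⊕ y) ⊕ z) ⊜ ((w ⊕ x) ⊕ y) ⊕ z) ≈-refl _ _ _ _)
  ... | 1F | uy≈a = ≈-trans (∙-cong uy≈a (sum-by-fibres u a c u≈a ys))
    (solve 4 (λ w x y z → w ⊕ ((x ⊕ y) ⊕ z) ⊜ (x ⊕ (w ⊕ y)) ⊕ z) ≈-refl _ _ _ _)
  ... | 2F | uy≈a = ≈-trans (∙-cong uy≈a (sum-by-fibres u a c u≈a ys))
    (solve 4 (λ w x y z → w ⊕ ((x ⊕ y) ⊕ z) ⊜ (x ⊕ y) ⊕ (w ⊕ z)) ≈-refl _ _ _ _)

module _ {c ℓ : Level} (F : CommutativeRing c ℓ) where
  open CommutativeRing F hiding (refl) renaming (sym to ≈-sym; trans to ≈-trans)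
  open import Algebra.Properties.Semiring.Mult semiring
    renaming (_×_ to _·_) using (×-assoc-*; ×-congʳ; ×-homo-+)
  open import Algebra.Properties.AbelianGroup +-abelianGroup using ()
    renaming (∙-cancelˡ to +-cancelˡ; ∙-cancelʳ to +-cancelʳ)
  open import Algebra.Properties.CommutativeSemigroup +-commutativeSemigroup using (xy∙z≈xz∙y)
  open import Algebra.Properties.CommutativeSemigroup ℕₚ.+-commutativeSemigroup using ()
    renaming (x∙yz≈xz∙y to ℕ-x∙yz≈xz∙y)
  open import Relation.Binary.Reasoning.Setoid setoid

  *-cancelˡ-invertible : ∀ {x y b c} → y * x ≈ 1# → x * b ≈ x * c → b ≈ c
  *-cancelˡ-invertible {x} {y} {b} {c} yx≈1 xb≈xc = begin
    b             ≈⟨ *-identityˡ b ⟨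
    1# * b        ≈⟨ *-congʳ yx≈1 ⟨
    (y * x) * b   ≈⟨ *-assoc y x b ⟩
    y * (x * b)   ≈⟨ *-congˡ xb≈xc ⟩
    y * (x * c)   ≈⟨ *-assoc y x c ⟨
    (y * x) * c   ≈⟨ *-congʳ yx≈1 ⟩
    1# * c        ≈⟨ *-identityˡ c ⟩
    c             ∎

  ·≈·1* : ∀ k x → k · x ≈ (k · 1#) * x
  ·≈·1* k x = ≈-sym (≈-trans (×-assoc-* k 1# x) (×-congʳ k (*-identityˡ x)))

  module _ (fieldCharZero : IsFieldCharZero F) where

    private
      invertible : ∀ x → ¬ x ≈ 0# → ∃ λ y → x * y ≈ 1#
      invertible = proj₁ (proj₂ fieldCharZero)

      charZero : ∀ k → ¬ suc k · 1# ≈ 0#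
      charZero = proj₂ (proj₂ fieldCharZero)

    ·-cancelʳ-≉ : ∀ {b c} → ¬ b ≈ c → ∀ d → d · b ≈ d · c → d ≡ 0
    ·-cancelʳ-≉ b≉c zero    _ = refl
    ·-cancelʳ-≉ {b} {c} b≉c (suc k) kb≈kc with invertible (suc k · 1#) (charZero k)
    ... | y , ky≈1 = ⊥-elim (b≉c (*-cancelˡ-invertible (≈-trans (*-comm y _) ky≈1) (begin
      (suc k · 1#) * b  ≈⟨ ·≈·1* (suc k) b ⟨
      suc k · b         ≈⟨ kb≈kc ⟩
      suc k · c         ≈⟨ ·≈·1* (suc k) c ⟩
      (suc k · 1#) * c  ∎)))

    private
      counts-unique-≤ : ∀ {b c} → ¬ b ≈ c → ∀ {p q p′ q′} → q ≤ q′ → p ℕ.+ q ≡ p′ ℕ.+ q′ →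
                        p · b + q · c ≈ p′ · b + q′ · c → q ≡ q′
      counts-unique-≤ {b} {c} b≉c {p} {q} {p′} q≤q′ sums eq with ℕₚ.m≤n⇒∃[o]m+o≡n q≤q′
      ... | d , refl = ≡.sym (≡.trans (cong (q ℕ.+_) d≡0) (ℕₚ.+-identityʳ q))
        where
        p≡p′+d : p ≡ p′ ℕ.+ d
        p≡p′+d = ℕₚ.+-cancelʳ-≡ q p (p′ ℕ.+ d) (≡.trans sums (ℕ-x∙yz≈xz∙y p′ q d))
        d≡0 : d ≡ 0
        d≡0 = ·-cancelʳ-≉ b≉c d (+-cancelˡ (p′ · b + q · c) (d · b) (d · c) (begin
          (p′ · b + q · c) + d · b  ≈⟨ xy∙z≈xz∙y _ _ _ ⟩
          (p′ · b + d · b) + q · c  ≈⟨ +-congʳ (×-homo-+ b p′ d) ⟨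
          (p′ ℕ.+ d) · b + q · c    ≈⟨ +-congʳ (reflexive (cong (_· b) p≡p′+d)) ⟨
          p · b + q · c             ≈⟨ eq ⟩
          p′ · b + (q ℕ.+ d) · c    ≈⟨ +-congˡ (×-homo-+ c q d) ⟩
          p′ · b + (q · c + d · c)  ≈⟨ +-assoc _ _ _ ⟨
          (p′ · b + q · c) + d · c  ∎))

    counts-unique : ∀ {b c} → ¬ b ≈ c → ∀ {p q p′ q′} → p ℕ.+ q ≡ p′ ℕ.+ q′ →
                    p · b + q · c ≈ p′ · b + q′ · c → p ≡ p′ × q ≡ q′
    counts-unique b≉c {p} {q} {p′} {q′} sums eq =
      ℕₚ.+-cancelʳ-≡ q p p′ (≡.trans sums (cong (p′ ℕ.+_) (≡.sym q≡q′))) , q≡q′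
      where
      q≡q′ : q ≡ q′
      q≡q′ with ℕₚ.≤-total q q′
      ... | inj₁ q≤q′ = counts-unique-≤ b≉c q≤q′ sums eq
      ... | inj₂ q′≤q = ≡.sym (counts-unique-≤ b≉c q′≤q (≡.sym sums) (≈-sym eq))

walk-exits : ∀ {A : Set} {R : A → A → Set} (Q : A → Bool) {x y} → Star R x y →
  Q x ≡ true → Q y ≡ false → ∃₂ λ z w → R z w × Q z ≡ true × Q w ≡ false
walk-exits Q ε Qx Qy with ≡.trans (≡.sym Qx) Qy
... | ()
walk-exits Q {x} (_◅_ {j = w} xw walk) Qx Qy with Q w in Qw
... | true  = walk-exits Q walk Qw Qy
... | false = x , w , xw , Qx , Qw

module _ {n : ℕ} (Γ : Graph n) where

  neighbours : Fin n → List (Fin n)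
  neighbours x = filter (λ y → adj Γ x y Bool.≟ true) (allFin n)

  hasNbrIn : (Fin n → Bool) → Fin n → Bool
  hasNbrIn S x = any (λ y → adj Γ x y ∧ S y) (allFin n)

  nbrsIn≡countIn : ∀ S x → nbrsIn Γ S x ≡ countIn S (neighbours x)
  nbrsIn≡countIn S x = countIn-∧ (adj Γ x) S (allFin n)

  nbrsIn-cong : ∀ {S T : Fin n → Bool} → (∀ y → S y ≡ T y) → ∀ x → nbrsIn Γ S x ≡ nbrsIn Γ T x
  nbrsIn-cong S≗T x = countIn-cong (λ y → cong (adj Γ x y ∧_) (S≗T y)) (allFin n)

  nbrsIn-none : ∀ {S x} → (∀ y → Adj Γ x y → S y ≡ false) → nbrsIn Γ S x ≡ 0
  nbrsIn-none {S} {x} none = countIn-none excluded (allFin n)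
    where
    excluded : ∀ y → adj Γ x y ∧ S y ≡ false
    excluded y with adj Γ x y in xy
    ... | false = refl
    ... | true  = none y xy

  nbrsIn-∅ : ∀ x → nbrsIn Γ (λ _ → false) x ≡ 0
  nbrsIn-∅ x = nbrsIn-none (λ _ _ → refl)

  nbrsIn-pos : ∀ {S x y} → Adj Γ x y → S y ≡ true → 0 < nbrsIn Γ S x
  nbrsIn-pos {y = y} xy Sy = countIn-pos (∈-allFin y) (∧-true⁺ xy Sy)

  nbrsIn-witness : ∀ S x → 0 < nbrsIn Γ S x → ∃ λ y → Adj Γ x y × S y ≡ true
  nbrsIn-witness S x pos with countIn-witness _ (allFin n) pos
  ... | y , xy∧Sy = y , ∧-true⁻ xy∧Sy

  hasNbrIn-true : ∀ {S x y} → Adj Γ x y → S y ≡ true → hasNbrIn S x ≡ true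
  hasNbrIn-true {S} {x} {y} xy Sy = any-true (λ y → adj Γ x y ∧ S y) (∈-allFin y) (∧-true⁺ xy Sy)

  hasNbrIn-false : ∀ {S x} → (∀ y → Adj Γ x y → S y ≡ false) → hasNbrIn S x ≡ false
  hasNbrIn-false {S} {x} none = any-false (λ y → adj Γ x y ∧ S y) excluded (allFin n)
    where
    excluded : ∀ y → adj Γ x y ∧ S y ≡ false
    excluded y with adj Γ x y in xy
    ... | false = refl
    ... | true  = none y xy

  length-neighbours : ∀ {m} → Regular Γ m → ∀ x → length (neighbours x) ≡ m
  length-neighbours regular x =
    ≡.trans (≡.sym (countIn-true (neighbours x))) (≡.trans (≡.sym (nbrsIn≡countIn (λ _ → true) x)) (regular x))

module ThreeValuedEigenvector
  {c ℓ : Level} (F : CommutativeRing c ℓ) (fieldCharZero : IsFieldCharZero F)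
  {n : ℕ} (Γ : Graph n) (m : ℕ) (connected : Connected Γ) (regular : Regular Γ m)
  (u : Fin n → CommutativeRing.Carrier F) (θ : CommutativeRing.Carrier F) (eigen : IsEigenvector F Γ u θ)
  (a : Fin 3 → CommutativeRing.Carrier F) (a-injective : ∀ i j → CommutativeRing._≈_ F (a i) (a j) → i ≡ j)
  (cls : Fin n → Fin 3) (u≈a∘cls : ∀ x → CommutativeRing._≈_ F (u x) (a (cls x)))
  (cls-surjective : ∀ i → ∃ λ x → cls x ≡ i)
  (C⁰-C²-nonadjacent : ∀ x y → cls x ≡ 0F → cls y ≡ 2F → ¬ Adj Γ x y)
  (β₁ : ℕ) (C¹-C²-nbrs : ∀ x → cls x ≡ 1F → nbrsIn Γ (fibre cls 2F) x ≡ β₁)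
  where

  open CommutativeRing F hiding (refl; zero) renaming (sym to ≈-sym; trans to ≈-trans)
  open import Algebra.Properties.Semiring.Mult semiring renaming (_×_ to _·_) using ()
  open import Algebra.Properties.AbelianGroup +-abelianGroup using () renaming (∙-cancelʳ to +-cancelʳ)

  nbrs : Fin 3 → Fin n → ℕ
  nbrs i = nbrsIn Γ (fibre cls i)

  degree-by-classes : ∀ x → (nbrs 0F x ℕ.+ nbrs 1F x) ℕ.+ nbrs 2F x ≡ m
  degree-by-classes x rewrite nbrsIn≡countIn Γ (fibre cls 0F) x | nbrsIn≡countIn Γ (fibre cls 1F) x
                            | nbrsIn≡countIn Γ (fibre cls 2F) x =
    ≡.trans (≡.sym (length-by-fibres cls (neighbours Γ x))) (length-neighbours Γ regular x)

  eigen-by-classes : ∀ {x i} → cls x ≡ i → (nbrs 0F x · a 0F + nbrs 1F x · a 1F) + nbrs 2F x · a 2F ≈ θ * a i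
  eigen-by-classes {x} refl rewrite nbrsIn≡countIn Γ (fibre cls 0F) x | nbrsIn≡countIn Γ (fibre cls 1F) x
                                  | nbrsIn≡countIn Γ (fibre cls 2F) x =
    ≈-trans (≈-sym (sum-by-fibres +-commutativeMonoid u a cls u≈a∘cls (neighbours Γ x)))
            (≈-trans (proj₂ eigen x) (*-congˡ (u≈a∘cls x)))

  C⁰-nbr-∉C² : ∀ {x} → cls x ≡ 0F → ∀ y → Adj Γ x y → fibre cls 2F y ≡ false
  C⁰-nbr-∉C² {x} cx y xy = fibre-≢ cls refl (λ cy → C⁰-C²-nonadjacent x y cx cy xy)

  C²-nbr-∉C⁰ : ∀ {x} → cls x ≡ 2F → ∀ y → Adj Γ x y → fibre cls 0F y ≡ false
  C²-nbr-∉C⁰ {x} cx y xy = fibre-≢ cls refl (λ cy → C⁰-C²-nonadjacent y x cy cx (≡.trans (sym Γ y x) xy))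

  no-C²-nbrs-on-C⁰ : ∀ {x} → cls x ≡ 0F → nbrs 2F x ≡ 0
  no-C²-nbrs-on-C⁰ cx = nbrsIn-none Γ (C⁰-nbr-∉C² cx)

  no-C⁰-nbrs-on-C² : ∀ {x} → cls x ≡ 2F → nbrs 0F x ≡ 0
  no-C⁰-nbrs-on-C² cx = nbrsIn-none Γ (C²-nbr-∉C⁰ cx)

  a-distinct : ∀ {i j} → ¬ i ≡ j → ¬ a i ≈ a j
  a-distinct i≢j aᵢ≈aⱼ = i≢j (a-injective _ _ aᵢ≈aⱼ)

  C⁰-profile : ∀ {x x′} → cls x ≡ 0F → cls x′ ≡ 0F → nbrs 0F x ≡ nbrs 0F x′ × nbrs 1F x ≡ nbrs 1F x′
  C⁰-profile {x} {x′} cx cx′ =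
    counts-unique F fieldCharZero (a-distinct (λ ())) (≡.trans (degree x cx) (≡.sym (degree x′ cx′)))
      (≈-trans (weighted x cx) (≈-sym (weighted x′ cx′)))
    where
    degree : ∀ y → cls y ≡ 0F → nbrs 0F y ℕ.+ nbrs 1F y ≡ m
    degree y cy with nbrs 2F y | no-C²-nbrs-on-C⁰ cy | degree-by-classes y
    ... | _ | refl | deg = ≡.trans (≡.sym (ℕₚ.+-identityʳ _)) deg
    weighted : ∀ y → cls y ≡ 0F → nbrs 0F y · a 0F + nbrs 1F y · a 1F ≈ θ * a 0F
    weighted y cy with nbrs 2F y | no-C²-nbrs-on-C⁰ cy | eigen-by-classes cy
    ... | _ | refl | eig = ≈-trans (≈-sym (+-identityʳ _)) eig

  C¹-profile : ∀ {x x′} → cls x ≡ 1F → cls x′ ≡ 1F → nbrs 0F x ≡ nbrs 0F x′ × nbrs 1F x ≡ nbrs 1F x′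
  C¹-profile {x} {x′} cx cx′ =
    counts-unique F fieldCharZero (a-distinct (λ ()))
      (ℕₚ.+-cancelʳ-≡ β₁ _ _ (≡.trans (degree x cx) (≡.sym (degree x′ cx′))))
      (+-cancelʳ (β₁ · a 2F) _ _ (≈-trans (weighted x cx) (≈-sym (weighted x′ cx′))))
    where
    degree : ∀ y → cls y ≡ 1F → (nbrs 0F y ℕ.+ nbrs 1F y) ℕ.+ β₁ ≡ m
    degree y cy with nbrs 2F y | C¹-C²-nbrs y cy | degree-by-classes y
    ... | _ | refl | deg = deg
    weighted : ∀ y → cls y ≡ 1F → (nbrs 0F y · a 0F + nbrs 1F y · a 1F) + β₁ · a 2F ≈ θ * a 1F
    weighted y cy with nbrs 2F y | C¹-C²-nbrs y cy | eigen-by-classes cy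
    ... | _ | refl | eig = eig

  C²-profile : ∀ {x x′} → cls x ≡ 2F → cls x′ ≡ 2F → nbrs 1F x ≡ nbrs 1F x′ × nbrs 2F x ≡ nbrs 2F x′
  C²-profile {x} {x′} cx cx′ =
    counts-unique F fieldCharZero (a-distinct (λ ())) (≡.trans (degree x cx) (≡.sym (degree x′ cx′)))
      (≈-trans (weighted x cx) (≈-sym (weighted x′ cx′)))
    where
    degree : ∀ y → cls y ≡ 2F → nbrs 1F y ℕ.+ nbrs 2F y ≡ m
    degree y cy with nbrs 0F y | no-C⁰-nbrs-on-C² cy | degree-by-classes y
    ... | _ | refl | deg = deg
    weighted : ∀ y → cls y ≡ 2F → nbrs 1F y · a 1F + nbrs 2F y · a 2F ≈ θ * a 2F
    weighted y cy with nbrs 0F y | no-C⁰-nbrs-on-C² cy | eigen-by-classes cy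
    ... | _ | refl | eig = ≈-trans (+-congʳ (≈-sym (+-identityˡ _))) eig

  nbrs-constant : ∀ {i x x′} → cls x ≡ i → cls x′ ≡ i → ∀ j → nbrs j x ≡ nbrs j x′
  nbrs-constant {0F} cx cx′ 0F = proj₁ (C⁰-profile cx cx′)
  nbrs-constant {0F} cx cx′ 1F = proj₂ (C⁰-profile cx cx′)
  nbrs-constant {0F} cx cx′ 2F = ≡.trans (no-C²-nbrs-on-C⁰ cx) (≡.sym (no-C²-nbrs-on-C⁰ cx′))
  nbrs-constant {1F} cx cx′ 0F = proj₁ (C¹-profile cx cx′)
  nbrs-constant {1F} cx cx′ 1F = proj₂ (C¹-profile cx cx′)
  nbrs-constant {1F} cx cx′ 2F = ≡.trans (C¹-C²-nbrs _ cx) (≡.sym (C¹-C²-nbrs _ cx′))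
  nbrs-constant {2F} cx cx′ 0F = ≡.trans (no-C⁰-nbrs-on-C² cx) (≡.sym (no-C⁰-nbrs-on-C² cx′))
  nbrs-constant {2F} cx cx′ 1F = proj₁ (C²-profile cx cx′)
  nbrs-constant {2F} cx cx′ 2F = proj₂ (C²-profile cx cx′)

  rep : Fin 3 → Fin n
  rep i = proj₁ (cls-surjective i)

  cls-rep : ∀ i → cls (rep i) ≡ i
  cls-rep i = proj₂ (cls-surjective i)

  adjacency-spreads : ∀ {i j w x} → cls w ≡ i → cls x ≡ i →
    (∃ λ y → Adj Γ w y × cls y ≡ j) → ∃ λ y → Adj Γ x y × cls y ≡ j
  adjacency-spreads {j = j} {w} {x} cw cx (y , wy , cy)
    with nbrsIn-witness Γ (fibre cls j) x
           (subst (0 <_) (nbrs-constant cw cx j) (nbrsIn-pos Γ wy (fibre⁺ cls cy)))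
  ... | z , xz , cz = z , xz , fibre⁻ cls cz

  C¹-meets-C⁰ : ∀ {x} → cls x ≡ 1F → ∃ λ y → Adj Γ x y × cls y ≡ 0F
  C¹-meets-C⁰ cx
    with walk-exits (fibre cls 0F) (connected (rep 0F) (rep 1F))
                    (fibre⁺ cls (cls-rep 0F)) (fibre-≢ cls (cls-rep 1F) (λ ()))
  ... | z , w , zw , z∈C⁰ , w∉C⁰ with cls w in cw | w∉C⁰
  ... | 0F | ()
  ... | 1F | _ = adjacency-spreads cw cx (z , ≡.trans (sym Γ w z) zw , fibre⁻ cls z∈C⁰)
  ... | 2F | _ = ⊥-elim (C⁰-C²-nonadjacent z w (fibre⁻ cls z∈C⁰) cw zw)

  C²-meets-C¹ : ∀ {x} → cls x ≡ 2F → ∃ λ y → Adj Γ x y × cls y ≡ 1F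
  C²-meets-C¹ cx
    with walk-exits (fibre cls 2F) (connected (rep 2F) (rep 0F))
                    (fibre⁺ cls (cls-rep 2F)) (fibre-≢ cls (cls-rep 0F) (λ ()))
  ... | z , w , zw , z∈C² , w∉C² with cls w in cw | w∉C²
  ... | 0F | _ = ⊥-elim (C⁰-C²-nonadjacent w z cw (fibre⁻ cls z∈C²) (≡.trans (sym Γ w z) zw))
  ... | 1F | _ = adjacency-spreads (fibre⁻ cls z∈C²) cx (w , zw , cw)
  ... | 2F | ()

  C⁰ : Fin n → Bool
  C⁰ = fibre cls 0F

  within₁ : Fin 3 → Bool
  within₁ 2F = false
  within₁ _  = true

  ball₁ : ∀ x → ball Γ C⁰ 1 x ≡ within₁ (cls x)
  ball₁ x with cls x in cx
  ... | 0F = refl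
  ... | 1F with C¹-meets-C⁰ cx
  ...   | y , xy , cy = hasNbrIn-true Γ xy (fibre⁺ cls cy)
  ball₁ x | 2F = hasNbrIn-false Γ (C²-nbr-∉C⁰ cx)

  ball₂ : ∀ x → ball Γ C⁰ 2 x ≡ true
  ball₂ x = ≡.trans (cong (_∨ hasNbrIn Γ (ball Γ C⁰ 1) x) (ball₁ x)) (within₂ refl)
    where
    within₂ : ∀ {i} → cls x ≡ i → within₁ i ∨ hasNbrIn Γ (ball Γ C⁰ 1) x ≡ true
    within₂ {0F} _  = refl
    within₂ {1F} _  = refl
    within₂ {2F} cx with C²-meets-C¹ cx
    ... | y , xy , cy = hasNbrIn-true Γ xy (≡.trans (ball₁ y) (cong within₁ cy))

  layer₁ : ∀ x → layer Γ C⁰ 1 x ≡ fibre cls 1F x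
  layer₁ x = ≡.trans (cong (_∧ not (C⁰ x)) (ball₁ x)) (table (cls x))
    where
    table : ∀ i → within₁ i ∧ not ⌊ i ≟ 0F ⌋ ≡ ⌊ i ≟ 1F ⌋
    table 0F = refl
    table 1F = refl
    table 2F = refl

  layer₂ : ∀ x → layer Γ C⁰ 2 x ≡ fibre cls 2F x
  layer₂ x = ≡.trans (cong₂ (λ b₂ b₁ → b₂ ∧ not b₁) (ball₂ x) (ball₁ x)) (table (cls x))
    where
    table : ∀ i → not (within₁ i) ≡ ⌊ i ≟ 2F ⌋
    table 0F = refl
    table 1F = refl
    table 2F = refl

  layer₃ : ∀ x → layer Γ C⁰ 3 x ≡ false
  layer₃ x = ≡.trans (cong (λ q → ball Γ C⁰ 3 x ∧ not q) (ball₂ x)) (∧-zeroʳ _)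

  layer-fibre : ∀ i x → layer Γ C⁰ (toℕ i) x ≡ fibre cls i x
  layer-fibre 0F _ = refl
  layer-fibre 1F   = layer₁
  layer-fibre 2F   = layer₂

  p : Fin 3 → Fin 3 → ℕ
  p i j = nbrs j (rep i)

  layer-nbrs : ∀ i j x → layer Γ C⁰ (toℕ i) x ≡ true → nbrsIn Γ (layer Γ C⁰ (toℕ j)) x ≡ p i j
  layer-nbrs i j x x∈Cᵢ =
    ≡.trans (nbrsIn-cong Γ (layer-fibre j) x)
            (nbrs-constant (fibre⁻ cls (≡.trans (≡.sym (layer-fibre i x)) x∈Cᵢ)) (cls-rep i) j)

  γ α β : ℕ → ℕ
  γ 0 = 0
  γ 1 = p 1F 0F
  γ _ = p 2F 1F
  α 0 = p 0F 0F
  α 1 = p 1F 1F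
  α _ = p 2F 2F
  β 0 = p 0F 1F
  β 1 = p 1F 2F
  β _ = 0

theorem4 : ∀ {c ℓ : Level} (F : CommutativeRing c ℓ) → IsFieldCharZero F →
  ∀ {n : ℕ} (Γ : Graph n) (m : ℕ) → Connected Γ → Regular Γ m →
  (u : Fin n → CommutativeRing.Carrier F) (θ : CommutativeRing.Carrier F) → IsEigenvector F Γ u θ →
  (a : Fin 3 → CommutativeRing.Carrier F) → (∀ i j → CommutativeRing._≈_ F (a i) (a j) → i ≡ j) →
  (cls : Fin n → Fin 3) → (∀ x → CommutativeRing._≈_ F (u x) (a (cls x))) → (∀ i → ∃ λ x → cls x ≡ i) →
  (∀ x y → cls x ≡ zero → cls y ≡ suc (suc zero) → ¬ (adj Γ x y ≡ true)) →
  (β₁ : ℕ) →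
  (∀ x → cls x ≡ suc zero → nbrsIn Γ (λ y → ⌊ cls y ≟ suc (suc zero) ⌋) x ≡ β₁) →
  CompletelyRegular Γ (λ x → ⌊ cls x ≟ zero ⌋)
theorem4 F fieldCharZero Γ m connected regular u θ eigen a a-injective cls u≈a∘cls cls-surjective
         C⁰-C²-nonadjacent β₁ C¹-C²-nbrs =
  2 , (ball₂ , rep 2F , ≡.trans (layer₂ (rep 2F)) (fibre⁺ cls (cls-rep 2F))) ,
  γ , α , β , refl , refl , λ where
    0 _ x x∈C₀ → nbrsIn-∅ Γ x , layer-nbrs 0F 0F x x∈C₀ , layer-nbrs 0F 1F x x∈C₀
    1 _ x x∈C₁ → layer-nbrs 1F 0F x x∈C₁ , layer-nbrs 1F 1F x x∈C₁ , layer-nbrs 1F 2F x x∈C₁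
    2 _ x x∈C₂ → layer-nbrs 2F 1F x x∈C₂ , layer-nbrs 2F 2F x x∈C₂ ,
                 ≡.trans (nbrsIn-cong Γ layer₃ x) (nbrsIn-∅ Γ x)
    (suc (suc (suc _))) (s≤s (s≤s ())) _ _
  where
  open ThreeValuedEigenvector F fieldCharZero Γ m connected regular u θ eigen a a-injective cls u≈a∘cls
         cls-surjective C⁰-C²-nonadjacent β₁ C¹-C²-nbrs
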